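{- Let $i\in\{1,\dots,n\}$ and $\pi,\rho\in S_n$ with $\pi^{ -1}(i)=\rho^{ -1}(i)$. Then for every $n$PC formula $F$, the sequent $F^\pi\vdash_i F^\rho$ is provable.
   Context: Fix $n\ge 2$, write $\hat n=\{1,\dots,n\}$, let $S_n$ be the group of permutations of $\hat n$ and $V$ a countable set of propositional variables. Formulas of $n$PC are: decorated variables $X^\pi$ ($X\in V$, $\pi\in S_n$); constants $\mathsf e_1,\dots,\mathsf e_n$; compound formulas $q(F,G_1,\dots,G_n)$. For $\rho\in S_n$, $F^\rho$ is defined by $(X^\pi)^\rho=X^{\rho\circ\pi}$, $(\mathsf e_k)^\rho=\mathsf e_{\rho(k)}$, $q(F,G_1,\dots,G_n)^\rho=q(F,G_1^\rho,\dots,G_n^\rho)$. $(ij)$ denotes the transposition exchanging $i$ and $j$ (identity if $i=j$). Contexts $\Gamma,\Delta$ are finite multisets of formulas, $\Gamma^\rho$ elementwise. Sequents $\Gamma\vdash_i\Delta$ ($i\in\hat n$) are provable if derivable by the rules (premises $\Rightarrow$ conclusion), for all $i,j,k\in\hat n$: (Const) $\Rightarrow\ \vdash_i\mathsf e_i$. (Id) $\Rightarrow X^\pi\vdash_i X^\rho$ whenever $\pi^{ -1}(i)=\rho^{ -1}(i)$. (Sym) $\Gamma^{(ij)}\vdash_i\Delta^{(ij)}\Rightarrow\Gamma\vdash_j\Delta$. (Neg1) if $i\ne k$: $\Gamma^{(ij)}\vdash_i F,\Delta^{(ij)}\Rightarrow \Gamma,F^{(jk)}\vdash_j\Delta$.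 (Neg2) if $j\neq k$: $\Gamma^{(ij)}\vdash_i F,\Delta^{(ij)}\Rightarrow \Gamma,F^{(ik)}\vdash_j\Delta$. (Neg3) $\{\Gamma^{(ij)},F\vdash_i\Delta^{(ij)}\}_{i\neq j}\Rightarrow\Gamma\vdash_j F,\Delta$. (qL) $\{\Gamma^{(ji)},F,G_j^{(ji)}\vdash_j\Delta^{(ji)}\}_{j\in\hat n}\Rightarrow \Gamma,q(F,G_1,\dots,G_n)\vdash_i\Delta$. (qR) $\{\Gamma^{(ji)},F\vdash_j G_j^{(ji)},\Delta^{(ji)}\}_{j\in\hat n}\Rightarrow\Gamma\vdash_i q(F,G_1,\dots,G_n),\Delta$. (Cut) $\Gamma,F\vdash_i\Delta$ and $\Gamma\vdash_i F,\Delta\Rightarrow\Gamma\vdash_i\Delta$. Left and right weakening and contraction in each $\vdash_i$. -}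

module Defs where

open import Data.Nat using (ℕ)
open import Data.Fin using (Fin)
open import Data.Fin.Permutation using (Permutation′; _∘ₚ_; transpose; _⟨$⟩ʳ_; _⟨$⟩ˡ_)
open import Data.List using (List; []; _∷_; map)
open import Data.List.Relation.Binary.Permutation.Propositional using (_↭_)
open import Relation.Binary.PropositionalEquality using (_≡_; _≢_)

-- Propositional variables: the countable set V is taken to be ℕ.
-- The index set n̂ = {1,…,n} is represented by Fin n; S_n by Permutation′ n.

data Form (n : ℕ) : Set where
  var   : ℕ → Permutation′ n → Form n
  const : Fin n → Form n
  q     : Form n → (Fin n → Form n) → Form n

-- the action F^ρ ;  (X^π)^ρ = X^(ρ ∘ π)  (ρ∘π = "first π then ρ" = π ∘ₚ ρ)
act : ∀ {n} → Form n → Permutation′ n → Form n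
act (var X π) ρ = var X (π ∘ₚ ρ)
act (const k) ρ = const (ρ ⟨$⟩ʳ k)
act (q F G)   ρ = q F (λ j → act (G j) ρ)

tr : ∀ {n} → Fin n → Fin n → Permutation′ n
tr i j = transpose i j

-- contexts: finite multisets, represented as lists up to permutation (rule exch)
Ctx : ℕ → Set
Ctx n = List (Form n)

actC : ∀ {n} → Ctx n → Permutation′ n → Ctx n
actC Γ ρ = map (λ F → act F ρ) Γ

data Provable {n : ℕ} : Fin n → Ctx n → Ctx n → Set where
  exch  : ∀ {i Γ Γ' Δ Δ'} → Γ ↭ Γ' → Δ ↭ Δ' → Provable i Γ Δ → Provable i Γ' Δ'
  const : ∀ {i} → Provable i [] (const i ∷ [])
  ident : ∀ {i X π ρ} → π ⟨$⟩ˡ i ≡ ρ ⟨$⟩ˡ i → Provable i (var X π ∷ []) (var X ρ ∷ [])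
  sym   : ∀ {i j Γ Δ} → Provable i (actC Γ (tr i j)) (actC Δ (tr i j)) → Provable j Γ Δ
  neg1  : ∀ {i j k Γ Δ F} → i ≢ k →
          Provable i (actC Γ (tr i j)) (F ∷ actC Δ (tr i j)) →
          Provable j (act F (tr j k) ∷ Γ) Δ
  neg2  : ∀ {i j k Γ Δ F} → j ≢ k →
          Provable i (actC Γ (tr i j)) (F ∷ actC Δ (tr i j)) →
          Provable j (act F (tr i k) ∷ Γ) Δ
  neg3  : ∀ {j Γ Δ F} →
          ((i : Fin n) → i ≢ j → Provable i (F ∷ actC Γ (tr i j)) (actC Δ (tr i j))) →
          Provable j Γ (F ∷ Δ)
  qL    : ∀ {i Γ Δ F G} →
          ((j : Fin n) → Provable j (F ∷ act (G j) (tr j i) ∷ actC Γ (tr j i)) (actC Δ (tr j i))) →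
          Provable i (q F G ∷ Γ) Δ
  qR    : ∀ {i Γ Δ F G} →
          ((j : Fin n) → Provable j (F ∷ actC Γ (tr j i)) (act (G j) (tr j i) ∷ actC Δ (tr j i))) →
          Provable i Γ (q F G ∷ Δ)
  cut   : ∀ {i Γ Δ F} → Provable i (F ∷ Γ) Δ → Provable i Γ (F ∷ Δ) → Provable i Γ Δ
  weakL : ∀ {i Γ Δ F} → Provable i Γ Δ → Provable i (F ∷ Γ) Δ
  weakR : ∀ {i Γ Δ F} → Provable i Γ Δ → Provable i Γ (F ∷ Δ)
  contrL : ∀ {i Γ Δ F} → Provable i (F ∷ F ∷ Γ) Δ → Provable i (F ∷ Γ) Δ
  contrR : ∀ {i Γ Δ F} → Provable i Γ (F ∷ F ∷ Δ) → Provable i Γ (F ∷ Δ)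

-- Since (F^σ)^τ and F^(τ∘σ) are not definitionally equal, the
-- claim is generalised from single permutations to words of permutations; the
-- hypothesis only constrains the preimage of i under the composite word. A constant e_k either lands on i under both
-- words (Const) or under neither, and then e_a ⊢_i holds by Neg1 with the
-- trivial transposition (ii). For q(F,G) apply qL and then qR: the premise of
-- index pair (j,l) contains F and F^(lj) on the left, which refute each other
-- by Neg1 when l ≠ j, while for l = j it is the induction hypothesis for G_j.
module Submission where

open import Defs
open import Data.Nat using (ℕ; _≤_)
open import Data.Fin using (Fin; _≟_)
open import Data.Fin.Permutation
  using (Permutation′; _⟨$⟩ˡ_; _⟨$⟩ʳ_; _∘ₚ_; inverseˡ; inverseʳ)
import Data.Fin.Permutation.Components as PC
open import Data.List using (List; []; _∷_)
open import Data.List.Relation.Binary.Permutation.Propositional using (↭-refl; ↭-sym)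
open import Data.List.Relation.Binary.Permutation.Propositional.Properties using (↭-reverse)
open import Relation.Binary.PropositionalEquality
  using (_≡_; _≢_; refl; trans; cong; subst; subst₂; module ≡-Reasoning)
  renaming (sym to ≡-sym)
open import Relation.Nullary.Decidable using (yes; no; dec-true; dec-false)

transpose-refl : ∀ {n} (l k : Fin n) → PC.transpose l l k ≡ k
transpose-refl l k with k ≟ l
... | yes refl = refl
... | no k≢l rewrite dec-false (k ≟ l) k≢l = refl

transpose-second : ∀ {n} (i j : Fin n) → PC.transpose i j j ≡ i
transpose-second i j with j ≟ i
... | yes refl = refl
... | no _ rewrite dec-true (j ≟ j) refl = refl

module _ {n : ℕ} where

  Word : Set
  Word = List (Permutation′ n)

  -- The head of a word acts last: F ⋆ (σ ∷ τ ∷ []) = (F^τ)^σ.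
  _⋆_ : Form n → Word → Form n
  F ⋆ []       = F
  F ⋆ (σ ∷ ps) = act (F ⋆ ps) σ

  _⟨$⟩ʳ*_ : Word → Fin n → Fin n
  []       ⟨$⟩ʳ* k = k
  (σ ∷ ps) ⟨$⟩ʳ* k = σ ⟨$⟩ʳ (ps ⟨$⟩ʳ* k)

  _⟨$⟩ˡ*_ : Word → Fin n → Fin n
  []       ⟨$⟩ˡ* i = i
  (σ ∷ ps) ⟨$⟩ˡ* i = ps ⟨$⟩ˡ* (σ ⟨$⟩ˡ i)

  _∘ₚ*_ : Permutation′ n → Word → Permutation′ n
  π ∘ₚ* []       = π
  π ∘ₚ* (σ ∷ ps) = (π ∘ₚ* ps) ∘ₚ σ

  ∘ₚ*-⟨$⟩ˡ : ∀ π ps i → (π ∘ₚ* ps) ⟨$⟩ˡ i ≡ π ⟨$⟩ˡ (ps ⟨$⟩ˡ* i)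
  ∘ₚ*-⟨$⟩ˡ π []       i = refl
  ∘ₚ*-⟨$⟩ˡ π (σ ∷ ps) i = ∘ₚ*-⟨$⟩ˡ π ps (σ ⟨$⟩ˡ i)

  inverseʳ* : ∀ ps i → ps ⟨$⟩ʳ* (ps ⟨$⟩ˡ* i) ≡ i
  inverseʳ* []       i = refl
  inverseʳ* (σ ∷ ps) i = trans (cong (σ ⟨$⟩ʳ_) (inverseʳ* ps (σ ⟨$⟩ˡ i))) (inverseʳ σ)

  inverseˡ* : ∀ ps k → ps ⟨$⟩ˡ* (ps ⟨$⟩ʳ* k) ≡ k
  inverseˡ* []       k = refl
  inverseˡ* (σ ∷ ps) k = trans (cong (ps ⟨$⟩ˡ*_) (inverseˡ σ)) (inverseˡ* ps k)

  ⋆-var : ∀ X π ps → var X π ⋆ ps ≡ var X (π ∘ₚ* ps)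
  ⋆-var X π []       = refl
  ⋆-var X π (σ ∷ ps) = cong (λ F → act F σ) (⋆-var X π ps)

  ⋆-const : ∀ k ps → const k ⋆ ps ≡ const (ps ⟨$⟩ʳ* k)
  ⋆-const k []       = refl
  ⋆-const k (σ ∷ ps) = cong (λ F → act F σ) (⋆-const k ps)

  ⋆-q : ∀ F G ps → q F G ⋆ ps ≡ q F (λ j → G j ⋆ ps)
  ⋆-q F G []       = refl
  ⋆-q F G (σ ∷ ps) = cong (λ H → act H σ) (⋆-q F G ps)

  ⟨$⟩ʳ*-transport : ∀ ps qs {i k} → ps ⟨$⟩ˡ* i ≡ qs ⟨$⟩ˡ* i →
                    ps ⟨$⟩ʳ* k ≡ i → qs ⟨$⟩ʳ* k ≡ i
  ⟨$⟩ʳ*-transport ps qs {i} {k} same ps·k≡i = begin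
    qs ⟨$⟩ʳ* k                      ≡⟨ cong (qs ⟨$⟩ʳ*_) (≡-sym (inverseˡ* ps k)) ⟩
    qs ⟨$⟩ʳ* (ps ⟨$⟩ˡ* (ps ⟨$⟩ʳ* k)) ≡⟨ cong (λ x → qs ⟨$⟩ʳ* (ps ⟨$⟩ˡ* x)) ps·k≡i ⟩
    qs ⟨$⟩ʳ* (ps ⟨$⟩ˡ* i)           ≡⟨ cong (qs ⟨$⟩ʳ*_) same ⟩
    qs ⟨$⟩ʳ* (qs ⟨$⟩ˡ* i)           ≡⟨ inverseʳ* qs i ⟩
    i                               ∎
    where open ≡-Reasoning

  const-refutes : ∀ {a j : Fin n} → a ≢ j → Provable j (const a ∷ []) []
  const-refutes {a} {j} a≢j =
    subst (λ x → Provable j (const x ∷ []) []) (transpose-refl j a)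
      (neg1 {i = a} {k = j} {Γ = []} {Δ = []} a≢j const)

  transposed-copy-refutes : ∀ {l j : Fin n} {F} → l ≢ j →
    Provable l (act F (tr l l) ∷ []) (F ∷ []) →
    Provable l (act F (tr l j) ∷ F ∷ []) []
  transposed-copy-refutes {l} l≢j F^ll⊢F = neg1 {i = l} {Γ = _ ∷ []} {Δ = []} l≢j F^ll⊢F

  ⋆-⊢ : ∀ (F : Form n) i ps qs → ps ⟨$⟩ˡ* i ≡ qs ⟨$⟩ˡ* i →
        Provable i (F ⋆ ps ∷ []) (F ⋆ qs ∷ [])
  ⋆-⊢ (var X π) i ps qs same rewrite ⋆-var X π ps | ⋆-var X π qs = ident (begin
    (π ∘ₚ* ps) ⟨$⟩ˡ i  ≡⟨ ∘ₚ*-⟨$⟩ˡ π ps i ⟩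
    π ⟨$⟩ˡ (ps ⟨$⟩ˡ* i) ≡⟨ cong (π ⟨$⟩ˡ_) same ⟩
    π ⟨$⟩ˡ (qs ⟨$⟩ˡ* i) ≡⟨ ≡-sym (∘ₚ*-⟨$⟩ˡ π qs i) ⟩
    (π ∘ₚ* qs) ⟨$⟩ˡ i  ∎)
    where open ≡-Reasoning
  ⋆-⊢ (const k) i ps qs same rewrite ⋆-const k ps | ⋆-const k qs with ps ⟨$⟩ʳ* k ≟ i
  ... | yes ps·k≡i = subst₂ (λ a b → Provable i (const a ∷ []) (const b ∷ []))
                       (≡-sym ps·k≡i) (≡-sym (⟨$⟩ʳ*-transport ps qs same ps·k≡i)) (weakL const)
  ... | no ps·k≢i  = weakR (const-refutes ps·k≢i)
  ⋆-⊢ (q F G) i ps qs same rewrite ⋆-q F G ps | ⋆-q F G qs = qL λ j → qR λ l → premise j l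
    where
      premise : ∀ j l → Provable l
        (F ∷ act F (tr l j) ∷ act (act (G j ⋆ ps) (tr j i)) (tr l j) ∷ [])
        (act (act (G l ⋆ qs) (tr j i)) (tr l j) ∷ [])
      premise j l with l ≟ j
      ... | yes refl = weakL (weakL (⋆-⊢ (G l) l (tr l l ∷ tr l i ∷ ps) (tr l l ∷ tr l i ∷ qs)
                         (subst (λ x → ps ⟨$⟩ˡ* x ≡ qs ⟨$⟩ˡ* x) (≡-sym (l↦i l)) same)))
        where
          l↦i : ∀ l → PC.transpose i l (PC.transpose l l l) ≡ i
          l↦i l = trans (cong (PC.transpose i l) (transpose-refl l l)) (transpose-second i l)
      ... | no l≢j = weakR (exch (↭-sym (↭-reverse (_ ∷ act F (tr l j) ∷ F ∷ []))) ↭-refl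
                       (weakL (transposed-copy-refutes l≢j (⋆-⊢ F l (tr l l ∷ []) [] (transpose-refl l l)))))

-- The argument does not need n ≥ 2.
lemma4p4 : (n : ℕ) → 2 ≤ n → (i : Fin n) (π ρ : Permutation′ n) →
    π ⟨$⟩ˡ i ≡ ρ ⟨$⟩ˡ i → (F : Form n) →
    Provable i (act F π ∷ []) (act F ρ ∷ [])
lemma4p4 n _ i π ρ π⁻¹i≡ρ⁻¹i F = ⋆-⊢ F i (π ∷ []) (ρ ∷ []) π⁻¹i≡ρ⁻¹i
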